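{- Let $\mathbb{M}=\langle\mathbf{A},D\rangle$ be a matrix model of $\vdash^{\leq}_{\mathbb{SDM}}$ with $\mathbf{A}\in\mathbb{SDM}$, and let $a,b\in A$. Then $\langle a,b\rangle\in\boldsymbol{\Omega}_{\mathbf{A}}(D)$ if and only if for all $c_1,c_2,c_3\in A$ the following hold: (i) $a\lor c_1\in D$ iff $b\lor c_1\in D$; (ii) $\neg(a\land c_2)\lor c_1\in D$ iff $\neg(b\land c_2)\lor c_1\in D$; (iii) $\neg(\neg(a\land c_3)\land c_2)\lor c_1\in D$ iff $\neg(\neg(b\land c_3)\land c_2)\lor c_1\in D$.
   Context: Language: binary $\land,\lor$, unary $\neg$, constants $\bot,\top$. A semi-De Morgan algebra is an algebra $\langle A;\land,\lor,\neg,\bot,\top\rangle$ with bounded distributive lattice reduct satisfying $\neg\bot\approx\top$, $\neg(x\lor y)\approx\neg x\land\neg y$, $\neg\top\approx\bot$, $\neg\neg(x\land y)\approx\neg\neg x\land\neg\neg y$, $\neg x\approx\neg\neg\neg x$; $\mathbb{SDM}$ is their variety. $\Gamma\vdash^{\leq}_{\mathbb{SDM}}\varphi$ iff for all $\mathbf{A}\in\mathbb{SDM}$, all non-empty lattice filters $F$ and all homomorphisms $h$ from the formula algebra to $\mathbf{A}$, $h[\Gamma]\subseteq F$ implies $h(\varphi)\in F$. A matrix is a pair $\langle\mathbf{A},D\rangle$ with $D\subseteq A$; it defines the logic $\vdash_{\mathbb{M}}$ ($\Gamma\vdash_{\mathbb{M}}\varphi$ iff every homomorphism $h$ with $h[\Gamma]\subseteq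 D$ has $h(\varphi)\in D$), and it is a model of a logic $\vdash$ if $\vdash\,\subseteq\,\vdash_{\mathbb{M}}$. The Leibniz congruence $\boldsymbol{\Omega}_{\mathbf{A}}(D)$ is the largest congruence $\theta$ of $\mathbf{A}$ compatible with $D$, i.e. such that $a\in D$ and $\langle a,b\rangle\in\theta$ imply $b\in D$. -}

module Defs where

open import Level using (Level; suc; zero)
open import Data.Nat using (ℕ)
open import Data.Product using (Σ; _×_; _,_)
open import Relation.Binary.PropositionalEquality using (_≡_)
open import Function.Bundles using (_⇔_)

record SDMAlg : Set₁ where
  infixr 7 _∧_
  infixr 6 _∨_
  infix  8 ∼_
  field
    Carrier : Set
    _∧_ _∨_ : Carrier → Carrier → Carrier
    ∼_      : Carrier → Carrier
    bot top : Carrier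
    ∧-assoc : ∀ x y z → (x ∧ y) ∧ z ≡ x ∧ (y ∧ z)
    ∨-assoc : ∀ x y z → (x ∨ y) ∨ z ≡ x ∨ (y ∨ z)
    ∧-comm  : ∀ x y → x ∧ y ≡ y ∧ x
    ∨-comm  : ∀ x y → x ∨ y ≡ y ∨ x
    ∧-absorbs-∨ : ∀ x y → x ∧ (x ∨ y) ≡ x
    ∨-absorbs-∧ : ∀ x y → x ∨ (x ∧ y) ≡ x
    ∧-distrib-∨ : ∀ x y z → x ∧ (y ∨ z) ≡ (x ∧ y) ∨ (x ∧ z)
    ∨-identity  : ∀ x → x ∨ bot ≡ x
    ∧-identity  : ∀ x → x ∧ top ≡ x
    ∼bot   : ∼ bot ≡ top
    ∼∨     : ∀ x y → ∼ (x ∨ y) ≡ (∼ x) ∧ (∼ y)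
    ∼top   : ∼ top ≡ bot
    ∼∼∧    : ∀ x y → ∼ ∼ (x ∧ y) ≡ (∼ ∼ x) ∧ (∼ ∼ y)
    ∼∼∼    : ∀ x → ∼ x ≡ ∼ ∼ ∼ x

  _≤_ : Carrier → Carrier → Set
  x ≤ y = x ∧ y ≡ x

data Fm : Set where
  var      : ℕ → Fm
  _⋀_ _⋁_  : Fm → Fm → Fm
  ¬f       : Fm → Fm
  ⊥f ⊤f    : Fm

module _ (A : SDMAlg) where
  open SDMAlg A

  eval : (ℕ → Carrier) → Fm → Carrier
  eval v (var n) = v n
  eval v (φ ⋀ ψ) = eval v φ ∧ eval v ψ
  eval v (φ ⋁ ψ) = eval v φ ∨ eval v ψ
  eval v (¬f φ)  = ∼ eval v φ
  eval v ⊥f      = bot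
  eval v ⊤f      = top

  record IsNonEmptyFilter (F : Carrier → Set) : Set where
    field
      nonempty : Σ Carrier F
      up-closed : ∀ {x y} → F x → x ≤ y → F y
      ∧-closed  : ∀ {x y} → F x → F y → F (x ∧ y)

  record IsCongruence (θ : Carrier → Carrier → Set) : Set where
    field
      θ-refl  : ∀ x → θ x x
      θ-sym   : ∀ {x y} → θ x y → θ y x
      θ-trans : ∀ {x y z} → θ x y → θ y z → θ x z
      θ-∧ : ∀ {x y u w} → θ x y → θ u w → θ (x ∧ u) (y ∧ w)
      θ-∨ : ∀ {x y u w} → θ x y → θ u w → θ (x ∨ u) (y ∨ w)
      θ-∼ : ∀ {x y} → θ x y → θ (∼ x) (∼ y)

  Compatible : (θ : Carrier → Carrier → Set) → (Carrier → Set) → Set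
  Compatible θ D = ∀ {x y} → D x → θ x y → D y

  -- ⟨a,b⟩ ∈ Ω_A(D): the pair lies in some congruence compatible with D,
  -- i.e. in the largest such congruence.
  Leibniz : (Carrier → Set) → Carrier → Carrier → Set₁
  Leibniz D a b = Σ (Carrier → Carrier → Set) λ θ →
    IsCongruence θ × Compatible θ D × θ a b

_⊢≤SDM_ : (Fm → Set) → Fm → Set₁
Γ ⊢≤SDM φ = (A : SDMAlg) → (F : SDMAlg.Carrier A → Set) → IsNonEmptyFilter A F →
  (h : ℕ → SDMAlg.Carrier A) → (∀ γ → Γ γ → F (eval A h γ)) → F (eval A h φ)

MatrixCons : (A : SDMAlg) → (SDMAlg.Carrier A → Set) → (Fm → Set) → Fm → Set
MatrixCons A D Γ φ = (h : ℕ → SDMAlg.Carrier A) →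
  (∀ γ → Γ γ → D (eval A h γ)) → D (eval A h φ)

IsModelSDM≤ : (A : SDMAlg) → (SDMAlg.Carrier A → Set) → Set₁
IsModelSDM≤ A D = ∀ Γ φ → Γ ⊢≤SDM φ → MatrixCons A D Γ φ

-- A model ⟨A, D⟩ of ⊢≤ has D a lattice filter, because it validates ⊢ ⊤, x ⊢ x ∨ y and
-- x, y ⊢ x ∧ y. Every congruence compatible with D relates only indiscernible elements,
-- since the tests (i)–(iii) are unary polynomials. Conversely indiscernibility is
-- compatible with D (test (i) with c₁ = ⊥) and is a congruence: each test applied to
-- x ∨ u, x ∧ u or ∼ x is a test on x with other parameters, possibly met with a term not
-- involving x, and a filter contains a meet iff it contains both meetands. For ∼ x,
-- tests (i) and (ii) are (ii) and (iii) with parameter ⊤, while the law ∼ x = ∼ ∼ ∼ x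
-- rewrites the term of test (iii) as ∼ (x ∧ c₂) ∧ ∼ (∼ c₃ ∧ c₂), bringing it back to test (ii).
module Submission where

open import Defs
open import Data.Empty using (⊥)
open import Data.Nat using (ℕ; zero; suc)
open import Data.Product using (_×_; _,_; proj₁; proj₂)
open import Data.Product.Function.NonDependent.Propositional using (_×-⇔_)
open import Data.Sum using (_⊎_; inj₁; inj₂)
open import Function.Bundles using (_⇔_; mk⇔; Equivalence)
open import Function.Construct.Composition using (_⇔-∘_)
open import Function.Construct.Identity using (⇔-id)
open import Function.Construct.Symmetry using (⇔-sym)
open import Relation.Binary.PropositionalEquality
  using (_≡_; refl; sym; trans; cong; cong₂; subst; subst₂; module ≡-Reasoning)

module SDMProperties (A : SDMAlg) where
  open SDMAlg A
  open ≡-Reasoning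

  ∨-absorbsʳ-∧ : ∀ p q → (p ∧ q) ∨ p ≡ p
  ∨-absorbsʳ-∧ p q = trans (∨-comm _ _) (∨-absorbs-∧ p q)

  ≤⇒∨≡ : ∀ {p q} → p ≤ q → p ∨ q ≡ q
  ≤⇒∨≡ {p} {q} p≤q = begin
    p ∨ q        ≡⟨ cong (_∨ q) (sym p≤q) ⟩
    (p ∧ q) ∨ q  ≡⟨ cong (_∨ q) (∧-comm p q) ⟩
    (q ∧ p) ∨ q  ≡⟨ ∨-absorbsʳ-∧ q p ⟩
    q            ∎

  ∧-distribʳ-∨ : ∀ p q r → (p ∨ q) ∧ r ≡ (p ∧ r) ∨ (q ∧ r)
  ∧-distribʳ-∨ p q r = begin
    (p ∨ q) ∧ r        ≡⟨ ∧-comm _ _ ⟩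
    r ∧ (p ∨ q)        ≡⟨ ∧-distrib-∨ r p q ⟩
    (r ∧ p) ∨ (r ∧ q)  ≡⟨ cong₂ _∨_ (∧-comm r p) (∧-comm r q) ⟩
    (p ∧ r) ∨ (q ∧ r)  ∎

  ∨-distribʳ-∧ : ∀ p q r → (p ∧ q) ∨ r ≡ (p ∨ r) ∧ (q ∨ r)
  ∨-distribʳ-∧ p q r = sym (begin
    (p ∨ r) ∧ (q ∨ r)                  ≡⟨ ∧-distribʳ-∨ p r (q ∨ r) ⟩
    (p ∧ (q ∨ r)) ∨ (r ∧ (q ∨ r))      ≡⟨ cong₂ _∨_ (∧-distrib-∨ p q r) r∧[q∨r]≡r ⟩
    ((p ∧ q) ∨ (p ∧ r)) ∨ r            ≡⟨ ∨-assoc _ _ _ ⟩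
    (p ∧ q) ∨ ((p ∧ r) ∨ r)            ≡⟨ cong ((p ∧ q) ∨_) p∧r∨r≡r ⟩
    (p ∧ q) ∨ r                        ∎)
    where
    r∧[q∨r]≡r : r ∧ (q ∨ r) ≡ r
    r∧[q∨r]≡r = trans (cong (r ∧_) (∨-comm q r)) (∧-absorbs-∨ r q)
    p∧r∨r≡r : (p ∧ r) ∨ r ≡ r
    p∧r∨r≡r = trans (cong (_∨ r) (∧-comm p r)) (∨-absorbsʳ-∧ r p)

  ∼-∼∼-elimˡ : ∀ p q → ∼ (∼ ∼ p ∧ q) ≡ ∼ (p ∧ q)
  ∼-∼∼-elimˡ p q = begin
    ∼ (∼ ∼ p ∧ q)              ≡⟨ ∼∼∼ _ ⟩
    ∼ ∼ ∼ (∼ ∼ p ∧ q)          ≡⟨ cong ∼_ (∼∼∧ (∼ ∼ p) q) ⟩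
    ∼ (∼ ∼ ∼ ∼ p ∧ ∼ ∼ q)      ≡⟨ cong (λ t → ∼ (t ∧ ∼ ∼ q)) (sym (cong ∼_ (∼∼∼ p))) ⟩
    ∼ (∼ ∼ p ∧ ∼ ∼ q)          ≡⟨ cong ∼_ (sym (∼∼∧ p q)) ⟩
    ∼ ∼ ∼ (p ∧ q)              ≡⟨ sym (∼∼∼ _) ⟩
    ∼ (p ∧ q)                  ∎

  ∼[[p∨q]∧r]≡∼[p∧r]∧∼[q∧r] : ∀ p q r → ∼ ((p ∨ q) ∧ r) ≡ ∼ (p ∧ r) ∧ ∼ (q ∧ r)
  ∼[[p∨q]∧r]≡∼[p∧r]∧∼[q∧r] p q r = trans (cong ∼_ (∧-distribʳ-∨ p q r)) (∼∨ _ _)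

  ∼[∼[∼p∧q]∧r]≡∼[p∧r]∧∼[∼q∧r] : ∀ p q r → ∼ (∼ (∼ p ∧ q) ∧ r) ≡ ∼ (p ∧ r) ∧ ∼ (∼ q ∧ r)
  ∼[∼[∼p∧q]∧r]≡∼[p∧r]∧∼[∼q∧r] p q r = begin
    ∼ (∼ (∼ p ∧ q) ∧ r)            ≡⟨ cong (λ t → ∼ (∼ t ∧ r)) (∧-comm (∼ p) q) ⟩
    ∼ (∼ (q ∧ ∼ p) ∧ r)            ≡⟨ cong (λ t → ∼ (t ∧ r)) (sym (∼-∼∼-elimˡ q (∼ p))) ⟩
    ∼ (∼ (∼ ∼ q ∧ ∼ p) ∧ r)        ≡⟨ cong (λ t → ∼ (∼ t ∧ r)) (∧-comm (∼ ∼ q) (∼ p)) ⟩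
    ∼ (∼ (∼ p ∧ ∼ ∼ q) ∧ r)        ≡⟨ cong (λ t → ∼ (t ∧ r)) (cong ∼_ (sym (∼∨ p (∼ q)))) ⟩
    ∼ (∼ ∼ (p ∨ ∼ q) ∧ r)          ≡⟨ ∼-∼∼-elimˡ (p ∨ ∼ q) r ⟩
    ∼ ((p ∨ ∼ q) ∧ r)              ≡⟨ ∼[[p∨q]∧r]≡∼[p∧r]∧∼[q∧r] p (∼ q) r ⟩
    ∼ (p ∧ r) ∧ ∼ (∼ q ∧ r)        ∎

⊢≤-⊤ : (λ _ → ⊥) ⊢≤SDM ⊤f
⊢≤-⊤ A F isFilter _ _ = up-closed (proj₂ nonempty) (∧-identity (proj₁ nonempty))
  where
  open SDMAlg A
  open IsNonEmptyFilter isFilter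

⊢≤-∨-intro : (_≡ var 0) ⊢≤SDM (var 0 ⋁ var 1)
⊢≤-∨-intro A F isFilter h premises =
  up-closed (premises (var 0) refl) (∧-absorbs-∨ (h 0) (h 1))
  where
  open SDMAlg A
  open IsNonEmptyFilter isFilter

⊢≤-∧-intro : (λ γ → γ ≡ var 0 ⊎ γ ≡ var 1) ⊢≤SDM (var 0 ⋀ var 1)
⊢≤-∧-intro A F isFilter h premises =
  ∧-closed (premises (var 0) (inj₁ refl)) (premises (var 1) (inj₂ refl))
  where open IsNonEmptyFilter isFilter

model⇒isNonEmptyFilter : (A : SDMAlg) (D : SDMAlg.Carrier A → Set) →
  IsModelSDM≤ A D → IsNonEmptyFilter A D
model⇒isNonEmptyFilter A D model = record
  { nonempty  = top , model _ ⊤f ⊢≤-⊤ (λ _ → top) (λ _ ())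
  ; up-closed = λ {p} {q} Dp p≤q →
      subst D (≤⇒∨≡ p≤q) (model _ (var 0 ⋁ var 1) ⊢≤-∨-intro (pair p q) (λ { _ refl → Dp }))
  ; ∧-closed  = λ {p} {q} Dp Dq →
      model _ (var 0 ⋀ var 1) ⊢≤-∧-intro (pair p q) (λ { _ (inj₁ refl) → Dp ; _ (inj₂ refl) → Dq })
  }
  where
  open SDMAlg A
  open SDMProperties A
  pair : Carrier → Carrier → ℕ → Carrier
  pair p q zero    = p
  pair p q (suc _) = q

module Indiscernibility (A : SDMAlg) (D : SDMAlg.Carrier A → Set) where
  open SDMAlg A

  Indiscernible : Carrier → Carrier → Set
  Indiscernible x y = ∀ c₁ c₂ c₃ →
    (D (x ∨ c₁) ⇔ D (y ∨ c₁))
    × (D (∼ (x ∧ c₂) ∨ c₁) ⇔ D (∼ (y ∧ c₂) ∨ c₁))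
    × (D (∼ (∼ (x ∧ c₃) ∧ c₂) ∨ c₁) ⇔ D (∼ (∼ (y ∧ c₃) ∧ c₂) ∨ c₁))

  module _ {x y : Carrier} (x≈y : Indiscernible x y) where

    test₁ : ∀ c₁ → D (x ∨ c₁) ⇔ D (y ∨ c₁)
    test₁ c₁ = proj₁ (x≈y c₁ top top)

    test₂ : ∀ c₁ c₂ → D (∼ (x ∧ c₂) ∨ c₁) ⇔ D (∼ (y ∧ c₂) ∨ c₁)
    test₂ c₁ c₂ = proj₁ (proj₂ (x≈y c₁ c₂ top))

    test₃ : ∀ c₁ c₂ c₃ → D (∼ (∼ (x ∧ c₃) ∧ c₂) ∨ c₁) ⇔ D (∼ (∼ (y ∧ c₃) ∧ c₂) ∨ c₁)
    test₃ c₁ c₂ c₃ = proj₂ (proj₂ (x≈y c₁ c₂ c₃))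

  indiscernible-refl : ∀ x → Indiscernible x x
  indiscernible-refl x _ _ _ = ⇔-id _ , ⇔-id _ , ⇔-id _

  indiscernible-sym : ∀ {x y} → Indiscernible x y → Indiscernible y x
  indiscernible-sym x≈y c₁ c₂ c₃ =
    ⇔-sym (test₁ x≈y c₁) , ⇔-sym (test₂ x≈y c₁ c₂) , ⇔-sym (test₃ x≈y c₁ c₂ c₃)

  indiscernible-trans : ∀ {x y z} → Indiscernible x y → Indiscernible y z → Indiscernible x z
  indiscernible-trans x≈y y≈z c₁ c₂ c₃ =
    test₁ y≈z c₁ ⇔-∘ test₁ x≈y c₁ ,
    test₂ y≈z c₁ c₂ ⇔-∘ test₂ x≈y c₁ c₂ ,
    test₃ y≈z c₁ c₂ c₃ ⇔-∘ test₃ x≈y c₁ c₂ c₃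

  compatible⇒⇔ : ∀ {θ} → IsCongruence A θ → Compatible A θ D → ∀ {p q} → θ p q → D p ⇔ D q
  compatible⇒⇔ isCong compat θpq =
    mk⇔ (λ Dp → compat Dp θpq) (λ Dq → compat Dq (IsCongruence.θ-sym isCong θpq))

  compatible⇒indiscernible : ∀ {θ} → IsCongruence A θ → Compatible A θ D →
    ∀ {x y} → θ x y → Indiscernible x y
  compatible⇒indiscernible isCong compat θxy c₁ c₂ c₃ =
    D-resp (θ-∨ θxy (θ-refl c₁)) ,
    D-resp (θ-∨ (θ-∼ (θ-∧ θxy (θ-refl c₂))) (θ-refl c₁)) ,
    D-resp (θ-∨ (θ-∼ (θ-∧ (θ-∼ (θ-∧ θxy (θ-refl c₃))) (θ-refl c₂))) (θ-refl c₁))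
    where
    open IsCongruence isCong
    D-resp = compatible⇒⇔ isCong compat

  module _ (isFilter : IsNonEmptyFilter A D) where
    open IsNonEmptyFilter isFilter
    open SDMProperties A

    D-∨ : ∀ {p} q → D p → D (p ∨ q)
    D-∨ {p} q Dp = up-closed Dp (∧-absorbs-∨ p q)

    D-∧⇔× : ∀ {p q} → D (p ∧ q) ⇔ (D p × D q)
    D-∧⇔× {p} {q} = mk⇔
      (λ Dp∧q → D-∧ˡ Dp∧q , D-∧ˡ (subst D (∧-comm p q) Dp∧q))
      (λ (Dp , Dq) → ∧-closed Dp Dq)
      where
      D-∧ˡ : ∀ {p q} → D (p ∧ q) → D p
      D-∧ˡ {p} {q} Dp∧q = subst D (∨-absorbsʳ-∧ p q) (D-∨ p Dp∧q)

    D-∧-cong : ∀ {p p′ q q′} → D p ⇔ D p′ → D q ⇔ D q′ → D (p ∧ q) ⇔ D (p′ ∧ q′)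
    D-∧-cong p⇔p′ q⇔q′ = ⇔-sym D-∧⇔× ⇔-∘ ((p⇔p′ ×-⇔ q⇔q′) ⇔-∘ D-∧⇔×)

    D-⇔-subst : ∀ {p p′ q q′} → p ≡ p′ → q ≡ q′ → D p ⇔ D q → D p′ ⇔ D q′
    D-⇔-subst = subst₂ (λ p q → D p ⇔ D q)

    indiscernible-∨ʳ : ∀ {x y} u → Indiscernible x y → Indiscernible (x ∨ u) (y ∨ u)
    indiscernible-∨ʳ {x} {y} u x≈y c₁ c₂ c₃ =
      D-⇔-subst (sym (∨-assoc x u c₁)) (sym (∨-assoc y u c₁)) (test₁ x≈y (u ∨ c₁)) ,
      D-⇔-subst (sym (split x)) (sym (split y)) (D-∧-cong (test₂ x≈y c₁ c₂) (⇔-id _)) ,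
      D-⇔-subst (sym (shift x)) (sym (shift y)) (test₃ x≈y c₁ (∼ (u ∧ c₃) ∧ c₂) c₃)
      where
      split : ∀ z → ∼ ((z ∨ u) ∧ c₂) ∨ c₁ ≡ (∼ (z ∧ c₂) ∨ c₁) ∧ (∼ (u ∧ c₂) ∨ c₁)
      split z = trans (cong (_∨ c₁) (∼[[p∨q]∧r]≡∼[p∧r]∧∼[q∧r] z u c₂)) (∨-distribʳ-∧ _ _ c₁)
      shift : ∀ z → ∼ (∼ ((z ∨ u) ∧ c₃) ∧ c₂) ∨ c₁ ≡ ∼ (∼ (z ∧ c₃) ∧ (∼ (u ∧ c₃) ∧ c₂)) ∨ c₁
      shift z = cong (λ t → ∼ t ∨ c₁)
        (trans (cong (_∧ c₂) (∼[[p∨q]∧r]≡∼[p∧r]∧∼[q∧r] z u c₃)) (∧-assoc _ _ c₂))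

    indiscernible-∧ʳ : ∀ {x y} u → Indiscernible x y → Indiscernible (x ∧ u) (y ∧ u)
    indiscernible-∧ʳ {x} {y} u x≈y c₁ c₂ c₃ =
      D-⇔-subst (sym (∨-distribʳ-∧ x u c₁)) (sym (∨-distribʳ-∧ y u c₁))
        (D-∧-cong (test₁ x≈y c₁) (⇔-id _)) ,
      D-⇔-subst (shift₂ x) (shift₂ y) (test₂ x≈y c₁ (u ∧ c₂)) ,
      D-⇔-subst (shift₃ x) (shift₃ y) (test₃ x≈y c₁ c₂ (u ∧ c₃))
      where
      shift₂ : ∀ z → ∼ (z ∧ (u ∧ c₂)) ∨ c₁ ≡ ∼ ((z ∧ u) ∧ c₂) ∨ c₁
      shift₂ z = cong (λ t → ∼ t ∨ c₁) (sym (∧-assoc z u c₂))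
      shift₃ : ∀ z → ∼ (∼ (z ∧ (u ∧ c₃)) ∧ c₂) ∨ c₁ ≡ ∼ (∼ ((z ∧ u) ∧ c₃) ∧ c₂) ∨ c₁
      shift₃ z = cong (λ t → ∼ (∼ t ∧ c₂) ∨ c₁) (sym (∧-assoc z u c₃))

    indiscernible-∼ : ∀ {x y} → Indiscernible x y → Indiscernible (∼ x) (∼ y)
    indiscernible-∼ {x} {y} x≈y c₁ c₂ c₃ =
      D-⇔-subst (unit₂ x) (unit₂ y) (test₂ x≈y c₁ top) ,
      D-⇔-subst (unit₃ x) (unit₃ y) (test₃ x≈y c₁ c₂ top) ,
      D-⇔-subst (sym (split x)) (sym (split y)) (D-∧-cong (test₂ x≈y c₁ c₂) (⇔-id _))
      where
      unit₂ : ∀ z → ∼ (z ∧ top) ∨ c₁ ≡ ∼ z ∨ c₁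
      unit₂ z = cong (λ t → ∼ t ∨ c₁) (∧-identity z)
      unit₃ : ∀ z → ∼ (∼ (z ∧ top) ∧ c₂) ∨ c₁ ≡ ∼ (∼ z ∧ c₂) ∨ c₁
      unit₃ z = cong (λ t → ∼ (∼ t ∧ c₂) ∨ c₁) (∧-identity z)
      split : ∀ z → ∼ (∼ (∼ z ∧ c₃) ∧ c₂) ∨ c₁ ≡ (∼ (z ∧ c₂) ∨ c₁) ∧ (∼ (∼ c₃ ∧ c₂) ∨ c₁)
      split z = trans (cong (_∨ c₁) (∼[∼[∼p∧q]∧r]≡∼[p∧r]∧∼[∼q∧r] z c₃ c₂)) (∨-distribʳ-∧ _ _ c₁)

    indiscernible-isCongruence : IsCongruence A Indiscernible
    indiscernible-isCongruence = record
      { θ-refl  = indiscernible-refl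
      ; θ-sym   = indiscernible-sym
      ; θ-trans = indiscernible-trans
      ; θ-∧     = λ {x} {y} {u} {w} x≈y u≈w → indiscernible-trans (indiscernible-∧ʳ u x≈y)
          (subst₂ Indiscernible (∧-comm u y) (∧-comm w y) (indiscernible-∧ʳ y u≈w))
      ; θ-∨     = λ {x} {y} {u} {w} x≈y u≈w → indiscernible-trans (indiscernible-∨ʳ u x≈y)
          (subst₂ Indiscernible (∨-comm u y) (∨-comm w y) (indiscernible-∨ʳ y u≈w))
      ; θ-∼     = indiscernible-∼
      }

    indiscernible-compatible : Compatible A Indiscernible D
    indiscernible-compatible {x} {y} Dx x≈y =
      subst D (∨-identity y) (Equivalence.to (test₁ x≈y bot) (subst D (sym (∨-identity x)) Dx))

proposition6p2 : (A : SDMAlg) → (D : SDMAlg.Carrier A → Set) → IsModelSDM≤ A D →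
    (a b : SDMAlg.Carrier A) →
    Leibniz A D a b ⇔
      (∀ c₁ c₂ c₃ →
        (D (SDMAlg._∨_ A a c₁) ⇔ D (SDMAlg._∨_ A b c₁))
        × (D (SDMAlg._∨_ A (SDMAlg.∼_ A (SDMAlg._∧_ A a c₂)) c₁) ⇔ D (SDMAlg._∨_ A (SDMAlg.∼_ A (SDMAlg._∧_ A b c₂)) c₁))
        × (D (SDMAlg._∨_ A (SDMAlg.∼_ A (SDMAlg._∧_ A (SDMAlg.∼_ A (SDMAlg._∧_ A a c₃)) c₂)) c₁) ⇔ D (SDMAlg._∨_ A (SDMAlg.∼_ A (SDMAlg._∧_ A (SDMAlg.∼_ A (SDMAlg._∧_ A b c₃)) c₂)) c₁)))
proposition6p2 A D model a b = mk⇔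
  (λ (θ , isCong , compat , θab) → compatible⇒indiscernible isCong compat θab)
  (λ a≈b → Indiscernible , indiscernible-isCongruence D-filter ,
           (λ {x} {y} → indiscernible-compatible D-filter {x} {y}) , a≈b)
  where
  open Indiscernibility A D
  D-filter : IsNonEmptyFilter A D
  D-filter = model⇒isNonEmptyFilter A D model
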